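{- In any pseudometric betweenness: (a) no pair of points is both a $\beta$-pair and a $\gamma$-pair; (b) any two distinct $\gamma$-pairs $\{a,b\}$, $\{c,d\}$ with $\overline{ab}=\overline{cd}$ are disjoint; (c) if $\{a,b\}$ and $\{c,d\}$ are distinct $\gamma$-pairs with $\overline{ab}=\overline{cd}$, then they are $\gamma$-related.
   Context: A ternary relation $\mathcal B$ on a set $V$ (write $[abc]$ for $(a,b,c)\in\mathcal B$) is a pseudometric betweenness if: (M0) if $[abc]$ then $a,b,c$ are distinct; (M1) if $[abc]$ then $[cba]$; (M2) if $[abc]$ then $[bac]$ does not hold; (M3) if $[abc]$ and $[acd]$ then $[abd]$ and $[bcd]$. For distinct $a,b$: $I(a,b)=\{x : [axb]\}$, $O(a,b)=\{x : [xab] \text{ or } [abx]\}$, and the line $\overline{ab} = \{a,b\}\cup I(a,b)\cup O(a,b)$. For four distinct points, $(a,b,c,d)$ is a parallelogram if $[abc]$, $[bcd]$, $[cda]$ and $[dab]$ hold; pairs $\{a,b\}$, $\{c,d\}$ are parallel if $(a,b,c,d)$ or $(a,b,d,c)$ is a parallelogram, and antipodal if $(a,c,b,d)$ is a parallelogram. For $a\neq b$, $x\neq y$, $\{a,b\}\neq\{x,y\}$ with $\overline{ab}=\overline{xy}$, the pairs $\{a,b\}$ and $\{x,y\}$ are $\beta$-related if they are parallel and $I(a,b)=I(x,y)=\emptyset$, and $\gamma$-related if they are antipodal and $O(a,b)=O(x,y)=\emptyset$. A pair $\{q,r\}$ is a $\beta$-pair (resp. $\gamma$-pair) if some other pair is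 $\beta$-related (resp. $\gamma$-related) to it. -}

module Defs where

open import Level using (Level; _⊔_; suc)
open import Data.Product using (_×_; Σ-syntax; ∃-syntax)
open import Data.Sum using (_⊎_)
open import Data.Empty using (⊥)
open import Relation.Nullary using (¬_)
open import Relation.Binary.PropositionalEquality using (_≡_; _≢_)

-- A pseudometric betweenness on a carrier V: a ternary relation [abc] = B a b c
-- satisfying (M0)-(M3).
record IsPseudometricBetweenness {v ℓ : Level} {V : Set v} (B : V → V → V → Set ℓ) : Set (v ⊔ ℓ) where
  field
    M0 : ∀ {a b c} → B a b c → (a ≢ b) × (b ≢ c) × (a ≢ c)
    M1 : ∀ {a b c} → B a b c → B c b a
    M2 : ∀ {a b c} → B a b c → ¬ B b a c
    M3 : ∀ {a b c d} → B a b c → B a c d → B a b d × B b c d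

module _ {v ℓ : Level} {V : Set v} (B : V → V → V → Set ℓ) where

  InI : V → V → V → Set ℓ
  InI a b x = B a x b

  InO : V → V → V → Set ℓ
  InO a b x = B x a b ⊎ B a b x

  InLine : V → V → V → Set (v ⊔ ℓ)
  InLine a b x = (x ≡ a) ⊎ (x ≡ b) ⊎ InI a b x ⊎ InO a b x

  SameLine : V → V → V → V → Set (v ⊔ ℓ)
  SameLine a b x y = ∀ z → (InLine a b z → InLine x y z) × (InLine x y z → InLine a b z)

  IEmpty : V → V → Set (v ⊔ ℓ)
  IEmpty a b = ∀ x → ¬ InI a b x

  OEmpty : V → V → Set (v ⊔ ℓ)
  OEmpty a b = ∀ x → ¬ InO a b x

  SamePair : V → V → V → V → Set v
  SamePair a b x y = ((a ≡ x) × (b ≡ y)) ⊎ ((a ≡ y) × (b ≡ x))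

  Parallelogram : V → V → V → V → Set (v ⊔ ℓ)
  Parallelogram a b c d =
    (a ≢ b) × (a ≢ c) × (a ≢ d) × (b ≢ c) × (b ≢ d) × (c ≢ d) ×
    B a b c × B b c d × B c d a × B d a b

  Parallel : V → V → V → V → Set (v ⊔ ℓ)
  Parallel a b c d = Parallelogram a b c d ⊎ Parallelogram a b d c

  Antipodal : V → V → V → V → Set (v ⊔ ℓ)
  Antipodal a b c d = Parallelogram a c b d

  Comparable : V → V → V → V → Set (v ⊔ ℓ)
  Comparable a b x y = (a ≢ b) × (x ≢ y) × ¬ SamePair a b x y × SameLine a b x y

  βRelated : V → V → V → V → Set (v ⊔ ℓ)
  βRelated a b x y = Comparable a b x y × Parallel a b x y × IEmpty a b × IEmpty x y

  γRelated : V → V → V → V → Set (v ⊔ ℓ)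
  γRelated a b x y = Comparable a b x y × Antipodal a b x y × OEmpty a b × OEmpty x y

  βPair : V → V → Set (v ⊔ ℓ)
  βPair q r = ∃[ x ] ∃[ y ] βRelated q r x y

  γPair : V → V → Set (v ⊔ ℓ)
  γPair q r = ∃[ x ] ∃[ y ] γRelated q r x y

-- On a line whose outer set O(a,b) is empty, every point other than a and b
-- lies between a and b.  A β-pair has I(a,b) empty while a γ-pair has
-- I(a,b) inhabited, which gives (a).  If two distinct γ-pairs on a common line
-- shared an endpoint p, their other endpoints q ≠ r would satisfy both [prq]
-- and [pqr], which (M3) and (M0) forbid; this gives (b).  The four remaining
-- betweenness relations of the antipodal parallelogram then come from the
-- first observation, which gives (c).
module Submission where

open import Defs
open import Level using (Level)
open import Data.Product using (_×_; _,_; proj₁; proj₂; ∃-syntax)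
open import Data.Sum using (inj₁; inj₂)
open import Data.Empty using (⊥; ⊥-elim)
open import Relation.Nullary using (¬_)
open import Relation.Binary.PropositionalEquality using (_≢_; ≢-sym; refl)

module PseudometricBetweenness {v ℓ : Level} {V : Set v} (B : V → V → V → Set ℓ)
                               (isPB : IsPseudometricBetweenness B) where
  open IsPseudometricBetweenness isPB

  -- (M3) with d := x yields [pxx], contradicting (M0).
  between-antisym : ∀ {p x y} → B p x y → ¬ B p y x
  between-antisym pxy pyx = proj₁ (proj₂ (M0 (proj₁ (M3 pxy pyx)))) refl

  left∈line : ∀ {a b} → InLine B a b a
  left∈line = inj₁ refl

  right∈line : ∀ {a b} → InLine B a b b
  right∈line = inj₂ (inj₁ refl)

  InLine-sym : ∀ {a b x} → InLine B a b x → InLine B b a x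
  InLine-sym (inj₁ x≡a)                      = inj₂ (inj₁ x≡a)
  InLine-sym (inj₂ (inj₁ x≡b))               = inj₁ x≡b
  InLine-sym (inj₂ (inj₂ (inj₁ axb)))        = inj₂ (inj₂ (inj₁ (M1 axb)))
  InLine-sym (inj₂ (inj₂ (inj₂ (inj₁ xab)))) = inj₂ (inj₂ (inj₂ (inj₂ (M1 xab))))
  InLine-sym (inj₂ (inj₂ (inj₂ (inj₂ abx)))) = inj₂ (inj₂ (inj₂ (inj₁ (M1 abx))))

  OEmpty-sym : ∀ {a b} → OEmpty B a b → OEmpty B b a
  OEmpty-sym o x (inj₁ xba) = o x (inj₂ (M1 xba))
  OEmpty-sym o x (inj₂ bax) = o x (inj₁ (M1 bax))

  OEmpty⇒between : ∀ {a b x} → OEmpty B a b → InLine B a b x → x ≢ a → x ≢ b → B a x b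
  OEmpty⇒between o (inj₁ x≡a)               x≢a x≢b = ⊥-elim (x≢a x≡a)
  OEmpty⇒between o (inj₂ (inj₁ x≡b))        x≢a x≢b = ⊥-elim (x≢b x≡b)
  OEmpty⇒between o (inj₂ (inj₂ (inj₁ axb))) x≢a x≢b = axb
  OEmpty⇒between o (inj₂ (inj₂ (inj₂ out))) x≢a x≢b = ⊥-elim (o _ out)

  OEmpty-lines-no-common-endpoint : ∀ {p q r} → OEmpty B p q → OEmpty B p r →
    InLine B p q r → InLine B p r q → p ≢ q → p ≢ r → q ≢ r → ⊥
  OEmpty-lines-no-common-endpoint opq opr r∈pq q∈pr p≢q p≢r q≢r =
    between-antisym
      (OEmpty⇒between opq r∈pq (≢-sym p≢r) (≢-sym q≢r))
      (OEmpty⇒between opr q∈pr (≢-sym p≢q) q≢r)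

  γPair⇒≢ : ∀ {a b} → γPair B a b → a ≢ b
  γPair⇒≢ (_ , _ , (a≢b , _) , _) = a≢b

  γPair⇒OEmpty : ∀ {a b} → γPair B a b → OEmpty B a b
  γPair⇒OEmpty (_ , _ , _ , _ , oab , _) = oab

  γPair⇒I-inhabited : ∀ {a b} → γPair B a b → ∃[ x ] InI B a b x
  γPair⇒I-inhabited (x , _ , _ , (_ , _ , _ , _ , _ , _ , axb , _) , _) = x , axb

  βPair⇒IEmpty : ∀ {a b} → βPair B a b → IEmpty B a b
  βPair⇒IEmpty (_ , _ , _ , _ , iab , _) = iab

  ¬βPair×γPair : ∀ a b → ¬ (βPair B a b × γPair B a b)
  ¬βPair×γPair a b (β , γ) with γPair⇒I-inhabited γ
  ... | x , axb = βPair⇒IEmpty β x axb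

  γPairs-disjoint : ∀ a b c d → γPair B a b → γPair B c d → ¬ SamePair B a b c d →
    SameLine B a b c d → (a ≢ c) × (a ≢ d) × (b ≢ c) × (b ≢ d)
  γPairs-disjoint a b c d γab γcd ab≠cd ab=cd = a≢c , a≢d , b≢c , b≢d
    where
    oab : OEmpty B a b
    oab = γPair⇒OEmpty γab
    ocd : OEmpty B c d
    ocd = γPair⇒OEmpty γcd
    a≢b : a ≢ b
    a≢b = γPair⇒≢ γab
    c≢d : c ≢ d
    c≢d = γPair⇒≢ γcd
    a∈cd : InLine B c d a
    a∈cd = proj₁ (ab=cd a) left∈line
    b∈cd : InLine B c d b
    b∈cd = proj₁ (ab=cd b) right∈line
    c∈ab : InLine B a b c
    c∈ab = proj₂ (ab=cd c) left∈line
    d∈ab : InLine B a b d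
    d∈ab = proj₂ (ab=cd d) right∈line

    a≢c : a ≢ c
    a≢c refl = OEmpty-lines-no-common-endpoint oab ocd d∈ab b∈cd
      a≢b c≢d (λ b≡d → ab≠cd (inj₁ (refl , b≡d)))
    a≢d : a ≢ d
    a≢d refl = OEmpty-lines-no-common-endpoint oab (OEmpty-sym ocd) c∈ab (InLine-sym b∈cd)
      a≢b (≢-sym c≢d) (λ b≡c → ab≠cd (inj₂ (refl , b≡c)))
    b≢c : b ≢ c
    b≢c refl = OEmpty-lines-no-common-endpoint (OEmpty-sym oab) ocd (InLine-sym d∈ab) a∈cd
      (≢-sym a≢b) c≢d (λ a≡d → ab≠cd (inj₂ (a≡d , refl)))
    b≢d : b ≢ d
    b≢d refl = OEmpty-lines-no-common-endpoint (OEmpty-sym oab) (OEmpty-sym ocd)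
      (InLine-sym c∈ab) (InLine-sym a∈cd)
      (≢-sym a≢b) (≢-sym c≢d) (λ a≡c → ab≠cd (inj₁ (a≡c , refl)))

  γPairs-γRelated : ∀ a b c d → γPair B a b → γPair B c d → ¬ SamePair B a b c d →
    SameLine B a b c d → γRelated B a b c d
  γPairs-γRelated a b c d γab γcd ab≠cd ab=cd =
    (a≢b , c≢d , ab≠cd , ab=cd) ,
    (a≢c , a≢b , a≢d , ≢-sym b≢c , c≢d , b≢d ,
      OEmpty⇒between oab (proj₂ (ab=cd c) left∈line) (≢-sym a≢c) (≢-sym b≢c) ,
      OEmpty⇒between ocd (proj₁ (ab=cd b) right∈line) b≢c b≢d ,
      M1 (OEmpty⇒between oab (proj₂ (ab=cd d) right∈line) (≢-sym a≢d) (≢-sym b≢d)) ,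
      M1 (OEmpty⇒between ocd (proj₁ (ab=cd a) left∈line) a≢c a≢d)) ,
    oab , ocd
    where
    oab : OEmpty B a b
    oab = γPair⇒OEmpty γab
    ocd : OEmpty B c d
    ocd = γPair⇒OEmpty γcd
    a≢b : a ≢ b
    a≢b = γPair⇒≢ γab
    c≢d : c ≢ d
    c≢d = γPair⇒≢ γcd
    disjoint : (a ≢ c) × (a ≢ d) × (b ≢ c) × (b ≢ d)
    disjoint = γPairs-disjoint a b c d γab γcd ab≠cd ab=cd
    a≢c : a ≢ c
    a≢c = proj₁ disjoint
    a≢d : a ≢ d
    a≢d = proj₁ (proj₂ disjoint)
    b≢c : b ≢ c
    b≢c = proj₁ (proj₂ (proj₂ disjoint))
    b≢d : b ≢ d
    b≢d = proj₂ (proj₂ (proj₂ disjoint))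

mainTheorem13 : ∀ {v ℓ : Level} {V : Set v} (B : V → V → V → Set ℓ) →
    IsPseudometricBetweenness B →
    (∀ a b → ¬ (βPair B a b × γPair B a b)) ×
    (∀ a b c d → γPair B a b → γPair B c d → ¬ SamePair B a b c d → SameLine B a b c d →
      (a ≢ c) × (a ≢ d) × (b ≢ c) × (b ≢ d)) ×
    (∀ a b c d → γPair B a b → γPair B c d → ¬ SamePair B a b c d → SameLine B a b c d →
      γRelated B a b c d)
mainTheorem13 B isPB = ¬βPair×γPair , γPairs-disjoint , γPairs-γRelated
  where open PseudometricBetweenness B isPB
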